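{- Let $\langle A_0;S_0;T_0;\theta_0\rangle\Longrightarrow^{*}\langle\emptyset;S_n;T_n;\theta_n\rangle$ be an $\textsc{AUnif}$ derivation. Then for all $\star\triangleq_u t\in T_n$ (respectively, all $s\triangleq_u\star\in T_n$) and all $\tau\in\Psi(T_n,S_n)$, there exists a term $r$ such that $u\tau\in\mathcal{G}_{\mathtt{Abs}}(r,t)$ (respectively, $u\tau\in\mathcal{G}_{\mathtt{Abs}}(r,s)$).
   Context: Terms are built over variables $\mathcal{V}$ and function symbols $\mathcal{F}$ containing a special constant $\star$ (wild card); $\mathcal{V}(t)$ is the variable set of $t$; $head(x)=x$, $head(f(t_1,\dots,t_n))=f$. Substitutions are postfix; $\mathit{Dom}(\sigma)=\{x\mid x\sigma\neq x\}$; $\mathit{Rvar}(\sigma)$ is the set of variables in its range. An absorption theory $\mathtt{Abs}$ is a finite union of axiom sets $\{f(x,\varepsilon_f)\approx\varepsilon_f, f(\varepsilon_f,x)\approx\varepsilon_f\}$ for pairwise distinct binary $f$; $f,\varepsilon_f$ are related absorption symbols; $\approx_{\mathtt{Abs}}$ the induced equality; $r\preceq_{\mathtt{Abs}}s$ iff $r\sigma\approx_{\mathtt{Abs}}s$ for some $\sigma$; $\mathcal{G}_{\mathtt{Abs}}(s,t)=\{r\mid r\preceq_{\mathtt{Abs}}s,\ r\preceq_{\mathtt{Abs}}t\}$. A term is in $\mathtt{Abs}$-normal form if no $\varepsilon_f$ occurs as an argument of $f$. An AUE is $s\triangleq_x t$ with label $x$; valid sets have pairwise distinct labels; wild AUE: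 a side is $\star$; solved AUE: $head(s)\neq head(t)$, not related absorption symbols, not wild. A configuration $\langle A;S;T;\theta\rangle$: $A$ valid set of AUEs, $S$ valid set of solved AUEs, $T$ valid set of wild AUEs, $\theta$ a substitution, all terms $\mathtt{Abs}$-normal, $labels(A),labels(S),labels(T),\mathit{Dom}(\theta)$ pairwise disjoint, $\mathit{Rvar}(\theta)=labels(A)\cup labels(S)\cup labels(T)$. Rules of $\textsc{AUnif}$ ($\uplus$ disjoint union; $y_i$ fresh; $f$ in Exp rules an absorption symbol): (Dec) $\langle\{f(s_1,\dots,s_n)\triangleq_x f(t_1,\dots,t_n)\}\uplus A;S;T;\theta\rangle\Longrightarrow\langle\{s_i\triangleq_{y_i}t_i\}_{i=1}^n\cup A;S;T;\theta\{x\mapsto f(y_1,\dots,y_n)\}\rangle$. (Sol) $\langle\{s\triangleq_x t\}\uplus A;S;T;\theta\rangle\Longrightarrow\langle A;\{s\triangleq_x t\}\cup S;T;\theta\rangle$ if $head(s)\neq head(t)$ and they are not related absorption symbols. (ExpLA1) $\langle\{\varepsilon_f\triangleq_x f(t_1,t_2)\}\uplus A;S;T;\theta\rangle\Longrightarrow\langle\{\varepsilon_f\triangleq_{y_1}t_1\}\cup A;S;\{\star\triangleq_{y_2}t_2\}\cup T;\theta\{x\mapsto f(y_1,y_2)\}\rangle$. (ExpLA2) same left side $\Longrightarrow\langle\{\varepsilon_f\triangleq_{y_2}t_2\}\cup A;S;\{\star\triangleq_{y_1}t_1\}\cup T;\theta\{x\mapsto f(y_1,y_2)\}\rangle$. (ExpRA1)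 $\langle\{f(s_1,s_2)\triangleq_x\varepsilon_f\}\uplus A;S;T;\theta\rangle\Longrightarrow\langle\{s_1\triangleq_{y_1}\varepsilon_f\}\cup A;S;\{s_2\triangleq_{y_2}\star\}\cup T;\theta\{x\mapsto f(y_1,y_2)\}\rangle$. (ExpRA2) same left side $\Longrightarrow\langle\{s_2\triangleq_{y_2}\varepsilon_f\}\cup A;S;\{s_1\triangleq_{y_1}\star\}\cup T;\theta\{x\mapsto f(y_1,y_2)\}\rangle$. (Mer) $\langle\emptyset;\{s\triangleq_x t,s\triangleq_y t\}\cup S;T;\theta\rangle\Longrightarrow\langle\emptyset;\{s\triangleq_y t\}\cup S;T;\theta\{x\mapsto y\}\rangle$. $\sigma_W=\{y\mapsto s\mid s\triangleq_y t\in W\}$, $\rho_W=\{y\mapsto t\mid s\triangleq_y t\in W\}$. Abstraction set: $\uparrow(t,\sigma)=\{r\mid r\sigma\approx_{\mathtt{Abs}}t,\ r\ \mathtt{Abs}\text{ -normal},\ \mathcal{V}(r)\subseteq\mathit{Dom}(\sigma)\}$. $\Psi(T,S)$ is the set of substitutions $\tau$ with $\mathit{Dom}(\tau)=labels(T)$ such that $y\tau\in\uparrow(t,\rho_S)$ if $\star\triangleq_y t\in T$ and $y\tau\in\uparrow(s,\sigma_S)$ if $s\triangleq_y\star\in T$. -}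

module Defs where

open import Data.Nat using (ℕ; _≟_)
open import Data.Fin using (Fin)
open import Data.Vec using (Vec; []; _∷_; lookup; toList; zipWith)
import Data.Vec as V
open import Data.List using (List; []; _∷_; _++_; map)
open import Data.List.Membership.Propositional using (_∈_)
open import Data.List.Relation.Unary.All using (All)
open import Data.List.Relation.Unary.Unique.Propositional using (Unique)
open import Data.List.Relation.Binary.Permutation.Propositional using (_↭_)
open import Data.Maybe using (Maybe; just; nothing)
open import Data.Product using (Σ; ∃; _×_; _,_)
open import Data.Sum using (_⊎_)
open import Data.Empty using (⊥)
open import Relation.Nullary using (¬_; yes; no)
open import Relation.Binary.PropositionalEquality using (_≡_; _≢_; subst; sym)
open import Function.Bundles using (_⇔_)

record Sig : Set₁ where
  field
    F       : Set
    arity   : F → ℕ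
    ⋆       : F
    ⋆-const : arity ⋆ ≡ 0

module Terms (Σg : Sig) where
  open Sig Σg

  data Term : Set where
    var : ℕ → Term
    app : (f : F) → Vec Term (arity f) → Term

  data Head : Set where
    hvar : ℕ → Head
    hsym : F → Head

  head : Term → Head
  head (var x)    = hvar x
  head (app f _)  = hsym f

  starT : Term
  starT = app ⋆ (subst (Vec Term) (sym ⋆-const) [])

  app2 : (f : F) → arity f ≡ 2 → Term → Term → Term
  app2 f p a b = app f (subst (Vec Term) (sym p) (a ∷ b ∷ []))

  Subst : Set
  Subst = ℕ → Term

  mutual
    _⟨_⟩ : Term → Subst → Term
    var x    ⟨ σ ⟩ = σ x
    app f ts ⟨ σ ⟩ = app f (ts ⟨ σ ⟩*)

    _⟨_⟩* : ∀ {n} → Vec Term n → Subst → Vec Term n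
    []       ⟨ σ ⟩* = []
    (t ∷ ts) ⟨ σ ⟩* = (t ⟨ σ ⟩) ∷ (ts ⟨ σ ⟩*)

  -- composition θ{x ↦ t} (postfix: first θ, then {x ↦ t})
  single : ℕ → Term → Subst
  single x t y with y ≟ x
  ... | yes _ = t
  ... | no  _ = var y

  _then[_↦_] : Subst → ℕ → Term → Subst
  (θ then[ x ↦ t ]) y = θ y ⟨ single x t ⟩

  data _occursIn_ (y : ℕ) : Term → Set where
    here  : y occursIn var y
    there : ∀ {f ts} (i : Fin (arity f)) → y occursIn lookup ts i → y occursIn app f ts

  Dom : Subst → ℕ → Set
  Dom σ x = σ x ≢ var x

  Rvar : Subst → ℕ → Set
  Rvar σ y = ∃ λ x → Dom σ x × y occursIn σ x

record AbsEntry (Σg : Sig) : Set where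
  open Sig Σg
  field
    f     : F
    ε     : F
    f-bin : arity f ≡ 2
    ε-con : arity ε ≡ 0

record AbsTheory (Σg : Sig) : Set where
  field
    entries  : List (AbsEntry Σg)
    distinct : Unique (map AbsEntry.f entries)

module Theory (Σg : Sig) (Abs : AbsTheory Σg) where
  open Sig Σg
  open Terms Σg public
  open AbsTheory Abs

  Related : Head → Head → Set
  Related h₁ h₂ = ∃ λ e → e ∈ entries ×
      ((h₁ ≡ hsym (AbsEntry.f e) × h₂ ≡ hsym (AbsEntry.ε e))
     ⊎ (h₁ ≡ hsym (AbsEntry.ε e) × h₂ ≡ hsym (AbsEntry.f e)))

  mutual
    data _≈_ : Term → Term → Set where
      ≈-refl  : ∀ {t} → t ≈ t
      ≈-sym   : ∀ {s t} → s ≈ t → t ≈ s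
      ≈-trans : ∀ {r s t} → r ≈ s → s ≈ t → r ≈ t
      ≈-cong  : ∀ {f ss ts} → Pw ss ts → app f ss ≈ app f ts
      ax-r    : ∀ {e x c} → e ∈ entries → head c ≡ hsym (AbsEntry.ε e) →
                app2 (AbsEntry.f e) (AbsEntry.f-bin e) x c ≈ c
      ax-l    : ∀ {e x c} → e ∈ entries → head c ≡ hsym (AbsEntry.ε e) →
                app2 (AbsEntry.f e) (AbsEntry.f-bin e) c x ≈ c

    data Pw : ∀ {n} → Vec Term n → Vec Term n → Set where
      []  : Pw [] []
      _∷_ : ∀ {n s t} {ss ts : Vec Term n} → s ≈ t → Pw ss ts → Pw (s ∷ ss) (t ∷ ts)

  _⪯_ : Term → Term → Set
  r ⪯ s = ∃ λ (σ : Subst) → (r ⟨ σ ⟩) ≈ s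

  -- r ∈ 𝒢_Abs(s , t)
  InG : Term → Term → Term → Set
  InG s t r = (r ⪯ s) × (r ⪯ t)

  mutual
    data NF : Term → Set where
      nf-var : ∀ {x} → NF (var x)
      nf-app : ∀ {g ts} → NFs ts →
               (∀ e → e ∈ entries → AbsEntry.f e ≡ g →
                  ∀ i → head (lookup ts i) ≢ hsym (AbsEntry.ε e)) →
               NF (app g ts)

    data NFs : ∀ {n} → Vec Term n → Set where
      []  : NFs []
      _∷_ : ∀ {n t} {ts : Vec Term n} → NF t → NFs ts → NFs (t ∷ ts)

  record AUE : Set where
    constructor _≜[_]_
    field
      lhs : Term
      lab : ℕ
      rhs : Term
  open AUE public

  labels : List AUE → List ℕ
  labels = map lab

  ValidSet : List AUE → Set
  ValidSet A = Unique (labels A)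

  IsStar : Term → Set
  IsStar t = head t ≡ hsym ⋆

  Wild : AUE → Set
  Wild e = IsStar (lhs e) ⊎ IsStar (rhs e)

  Solved : AUE → Set
  Solved e = head (lhs e) ≢ head (rhs e) × ¬ Related (head (lhs e)) (head (rhs e)) × ¬ Wild e

  NormalAUE : AUE → Set
  NormalAUE e = NF (lhs e) × NF (rhs e)

  record Config : Set where
    constructor ⟨_︔_︔_︔_⟩
    field
      A S T : List AUE
      θ     : Subst
  open Config public

  Disjoint : (ℕ → Set) → (ℕ → Set) → Set
  Disjoint P Q = ∀ y → P y → Q y → ⊥

  InL : List ℕ → ℕ → Set
  InL L y = y ∈ L

  record IsConfig (c : Config) : Set where
    field
      validA : ValidSet (A c)
      validS : ValidSet (S c)
      validT : ValidSet (T c)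
      solvedS : All Solved (S c)
      wildT   : All Wild (T c)
      normA : All NormalAUE (A c)
      normS : All NormalAUE (S c)
      normT : All NormalAUE (T c)
      disjAS : Disjoint (InL (labels (A c))) (InL (labels (S c)))
      disjAT : Disjoint (InL (labels (A c))) (InL (labels (T c)))
      disjST : Disjoint (InL (labels (S c))) (InL (labels (T c)))
      disjAθ : Disjoint (InL (labels (A c))) (Dom (θ c))
      disjSθ : Disjoint (InL (labels (S c))) (Dom (θ c))
      disjTθ : Disjoint (InL (labels (T c))) (Dom (θ c))
      rvar   : ∀ y → Rvar (θ c) y ⇔ (y ∈ labels (A c) ++ labels (S c) ++ labels (T c))

  OccursInAUE : ℕ → AUE → Set
  OccursInAUE y e = y occursIn lhs e ⊎ y occursIn rhs e

  Fresh : Config → ℕ → Set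
  Fresh c y = ¬ y ∈ labels (A c ++ S c ++ T c)
            × ¬ Dom (θ c) y × ¬ Rvar (θ c) y
            × (∀ e → e ∈ A c ++ S c ++ T c → ¬ OccursInAUE y e)

  FreshAll : Config → List ℕ → Set
  FreshAll c ys = All (Fresh c) ys × Unique ys

  data Step : Config → Config → Set where
    Dec : ∀ {A A' S T θ x f} {ss ts : Vec Term (arity f)} (ys : Vec ℕ (arity f)) →
          A ↭ ((app f ss ≜[ x ] app f ts) ∷ A') →
          FreshAll ⟨ A ︔ S ︔ T ︔ θ ⟩ (toList ys) →
          Step ⟨ A ︔ S ︔ T ︔ θ ⟩
               ⟨ toList (zipWith (λ (st : Term × Term) y → let (s , t) = st in s ≜[ y ] t)
                                 (zipWith _,_ ss ts) ys) ++ A'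
               ︔ S ︔ T ︔ θ then[ x ↦ app f (V.map var ys) ] ⟩
    Sol : ∀ {A A' S T θ s x t} →
          A ↭ ((s ≜[ x ] t) ∷ A') →
          head s ≢ head t → ¬ Related (head s) (head t) →
          Step ⟨ A ︔ S ︔ T ︔ θ ⟩ ⟨ A' ︔ (s ≜[ x ] t) ∷ S ︔ T ︔ θ ⟩
    ExpLA1 : ∀ {A A' S T θ c x t₁ t₂ y₁ y₂} (e : AbsEntry Σg) → e ∈ entries →
          head c ≡ hsym (AbsEntry.ε e) →
          A ↭ ((c ≜[ x ] app2 (AbsEntry.f e) (AbsEntry.f-bin e) t₁ t₂) ∷ A') →
          FreshAll ⟨ A ︔ S ︔ T ︔ θ ⟩ (y₁ ∷ y₂ ∷ []) →
          Step ⟨ A ︔ S ︔ T ︔ θ ⟩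
               ⟨ (c ≜[ y₁ ] t₁) ∷ A' ︔ S ︔ (starT ≜[ y₂ ] t₂) ∷ T
               ︔ θ then[ x ↦ app2 (AbsEntry.f e) (AbsEntry.f-bin e) (var y₁) (var y₂) ] ⟩
    ExpLA2 : ∀ {A A' S T θ c x t₁ t₂ y₁ y₂} (e : AbsEntry Σg) → e ∈ entries →
          head c ≡ hsym (AbsEntry.ε e) →
          A ↭ ((c ≜[ x ] app2 (AbsEntry.f e) (AbsEntry.f-bin e) t₁ t₂) ∷ A') →
          FreshAll ⟨ A ︔ S ︔ T ︔ θ ⟩ (y₁ ∷ y₂ ∷ []) →
          Step ⟨ A ︔ S ︔ T ︔ θ ⟩
               ⟨ (c ≜[ y₂ ] t₂) ∷ A' ︔ S ︔ (starT ≜[ y₁ ] t₁) ∷ T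
               ︔ θ then[ x ↦ app2 (AbsEntry.f e) (AbsEntry.f-bin e) (var y₁) (var y₂) ] ⟩
    ExpRA1 : ∀ {A A' S T θ c x s₁ s₂ y₁ y₂} (e : AbsEntry Σg) → e ∈ entries →
          head c ≡ hsym (AbsEntry.ε e) →
          A ↭ ((app2 (AbsEntry.f e) (AbsEntry.f-bin e) s₁ s₂ ≜[ x ] c) ∷ A') →
          FreshAll ⟨ A ︔ S ︔ T ︔ θ ⟩ (y₁ ∷ y₂ ∷ []) →
          Step ⟨ A ︔ S ︔ T ︔ θ ⟩
               ⟨ (s₁ ≜[ y₁ ] c) ∷ A' ︔ S ︔ (s₂ ≜[ y₂ ] starT) ∷ T
               ︔ θ then[ x ↦ app2 (AbsEntry.f e) (AbsEntry.f-bin e) (var y₁) (var y₂) ] ⟩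
    ExpRA2 : ∀ {A A' S T θ c x s₁ s₂ y₁ y₂} (e : AbsEntry Σg) → e ∈ entries →
          head c ≡ hsym (AbsEntry.ε e) →
          A ↭ ((app2 (AbsEntry.f e) (AbsEntry.f-bin e) s₁ s₂ ≜[ x ] c) ∷ A') →
          FreshAll ⟨ A ︔ S ︔ T ︔ θ ⟩ (y₁ ∷ y₂ ∷ []) →
          Step ⟨ A ︔ S ︔ T ︔ θ ⟩
               ⟨ (s₂ ≜[ y₂ ] c) ∷ A' ︔ S ︔ (s₁ ≜[ y₁ ] starT) ∷ T
               ︔ θ then[ x ↦ app2 (AbsEntry.f e) (AbsEntry.f-bin e) (var y₁) (var y₂) ] ⟩
    Mer : ∀ {S S' T θ s t x y} →
          S ↭ ((s ≜[ x ] t) ∷ (s ≜[ y ] t) ∷ S') →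
          Step ⟨ [] ︔ S ︔ T ︔ θ ⟩ ⟨ [] ︔ (s ≜[ y ] t) ∷ S' ︔ T ︔ θ then[ x ↦ var y ] ⟩

  -- σ_W and ρ_W (lookup by label; labels in a valid set are distinct)
  lookupLab : List AUE → ℕ → Maybe AUE
  lookupLab [] y = nothing
  lookupLab (e ∷ W) y with lab e ≟ y
  ... | yes _ = just e
  ... | no  _ = lookupLab W y

  σW : List AUE → Subst
  σW W y with lookupLab W y
  ... | just e  = lhs e
  ... | nothing = var y

  ρW : List AUE → Subst
  ρW W y with lookupLab W y
  ... | just e  = rhs e
  ... | nothing = var y

  InAbstr : Term → Subst → Term → Set
  InAbstr t σ r = ((r ⟨ σ ⟩) ≈ t) × NF r × (∀ y → y occursIn r → Dom σ y)

  InΨ : List AUE → List AUE → Subst → Set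
  InΨ T S τ = (∀ y → Dom τ y ⇔ (y ∈ labels T))
            × (∀ e → e ∈ T → IsStar (lhs e) → InAbstr (rhs e) (ρW S) (τ (lab e)))
            × (∀ e → e ∈ T → IsStar (rhs e) → InAbstr (lhs e) (σW S) (τ (lab e)))

-- Take r := uτ. It generalizes itself via the identity substitution, and since τ ∈ Ψ it is
-- an abstraction of t under ρ_S (resp. of s under σ_S), hence generalizes that side too.
-- Only the membership τ ∈ Ψ(Tₙ, Sₙ) is used, not the derivation.
module Submission where

open import Defs
open import Data.List using (List; [])
open import Data.List.Membership.Propositional using (_∈_)
open import Data.Product using (∃; _×_; _,_; proj₁)
open import Data.Vec using (Vec; []; _∷_)
open import Relation.Binary.Construct.Closure.ReflexiveTransitive using (Star)
open import Relation.Binary.PropositionalEquality using (_≡_; refl; cong; cong₂; subst; sym)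

module IdentitySubstitution (Σg : Sig) where
  open Terms Σg

  mutual
    ⟨var⟩-identity : (t : Term) → t ⟨ var ⟩ ≡ t
    ⟨var⟩-identity (var x)    = refl
    ⟨var⟩-identity (app f ts) = cong (app f) (⟨var⟩*-identity ts)

    ⟨var⟩*-identity : ∀ {n} (ts : Vec Term n) → ts ⟨ var ⟩* ≡ ts
    ⟨var⟩*-identity []       = refl
    ⟨var⟩*-identity (t ∷ ts) = cong₂ _∷_ (⟨var⟩-identity t) (⟨var⟩*-identity ts)

module AbsorptionPreorder (Σg : Sig) (Abs : AbsTheory Σg) where
  open Theory Σg Abs
  open IdentitySubstitution Σg

  ⪯-refl : (t : Term) → t ⪯ t
  ⪯-refl t = var , subst (_≈ t) (sym (⟨var⟩-identity t)) ≈-refl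

  InAbstr⇒⪯ : ∀ {t σ r} → InAbstr t σ r → r ⪯ t
  InAbstr⇒⪯ {σ = σ} r∈↑ = σ , proj₁ r∈↑

  self-InG : ∀ {r t} → r ⪯ t → InG r t r
  self-InG {r} r⪯t = ⪯-refl r , r⪯t

lemma2 : (Σg : Sig) (Abs : AbsTheory Σg) →
    let open Theory Σg Abs in
    (c₀ : Config) (Sₙ Tₙ : List AUE) (θₙ : Subst) →
    IsConfig c₀ → Star Step c₀ ⟨ [] ︔ Sₙ ︔ Tₙ ︔ θₙ ⟩ →
    (u : AUE) → u ∈ Tₙ → (τ : Subst) → InΨ Tₙ Sₙ τ →
    (IsStar (lhs u) → ∃ λ r → InG r (rhs u) (τ (lab u)))
    × (IsStar (rhs u) → ∃ λ r → InG r (lhs u) (τ (lab u)))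
lemma2 Σg Abs _ _ _ _ _ _ u u∈Tₙ τ (_ , wild-left , wild-right) =
    (λ ⋆-left  → τ (lab u) , self-InG (InAbstr⇒⪯ (wild-left u u∈Tₙ ⋆-left)))
  , (λ ⋆-right → τ (lab u) , self-InG (InAbstr⇒⪯ (wild-right u u∈Tₙ ⋆-right)))
  where open Theory Σg Abs
        open AbsorptionPreorder Σg Abs
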